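{- Let $\mathcal{A}_i$ and $\mathcal{A}_s$ be two pQTSs over the same action signature $(L_I,L_O^{\delta})$. If $\mathcal{A}_i\sqsubseteq_{\mathit{TD}}\mathcal{A}_s$, then $\mathcal{A}_i\sqsubseteq_{\mathit{pioco}}\mathcal{A}_s$.
   Context: A discrete probability distribution over a set $X$ is a function $\mu: X\to[0,1]$ with $\sum_{x\in X}\mu(x)=1$; $\mathit{Distr}(X)$ is the set of these. A probabilistic quiescent transition system (pQTS) is a tuple $\mathcal{A}=(S,s_0,L_I,L_O^{\delta},\Delta)$ where $S$ is a finite set of states, $s_0\in S$ is initial, $L_I$ (inputs) and $L_O^{\delta}$ (outputs) are disjoint sets of actions with a distinguished quiescence label $\delta\in L_O^{\delta}$, $L:=L_I\cup L_O^{\delta}$, and $\Delta\subseteq S\times \mathit{Distr}(L\times S)$ is a finite transition relation such that for every $(s,\mu)\in\Delta$, if $\mu(a?,s')>0$ for some input $a?\in L_I$, then $\mu(b,s'')=0$ for all $b\neq a?$ and all $s''$. We write $s\xrightarrow{\mu,a}s'$ if $(s,\mu)\in\Delta$ and $\mu(a,s')>0$. A path is a sequence $s_1\mu_1a_1s_2\mu_2a_2\ldots$ with $s_i\xrightarrow{\mu_i,a_i}s_{i+1}$, finite paths ending in a state; its trace is $a_1a_2\ldots$. An adversary of $\mathcal{A}$ is a function $E$ from finite paths (starting in $s_0$) to $\mathit{Distr}(\mathit{Distr}(L\times S)\cup\{\perp\})$ such that $E(\pi)(\mu)>0$ implies $(\mathit{last}(\pi),\mu)\in\Delta$; $E(\pi)(\perp)$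 is the halting probability. $E$ halts after $k$ steps if $E(\pi)(\perp)=1$ for every path $\pi$ with at least $k$ transitions. Path probabilities: $Q^E(s_0)=1$, $Q^E(\pi\mu a s)=Q^E(\pi)\cdot E(\pi)(\mu)\cdot\mu(a,s)$. The trace distribution $H=\mathit{trd}(E)$ is the induced probability measure on traces; for $\beta\in L^*$, $P_H(\beta)=\sum\{Q^E(\pi)\mid \pi$ finite path from $s_0$ with trace $\beta\}$ (the probability of the cone of traces extending $\beta$). Trace distributions are equal iff they agree on all $P_H(\beta)$. $\mathit{trd}(\mathcal{A})$ is the set of trace distributions of adversaries of $\mathcal{A}$, $\mathit{trd}(\mathcal{A},k)$ those of adversaries halting after $k$ steps. $\mathcal{A}\sqsubseteq_{\mathit{TD}}\mathcal{B}$ means $\mathit{trd}(\mathcal{A})\subseteq\mathit{trd}(\mathcal{B})$, i.e. for every $H\in\mathit{trd}(\mathcal{A})$ there is $H'\in\mathit{trd}(\mathcal{B})$ with $P_H(\sigma)=P_{H'}(\sigma)$ for all traces $\sigma$. For $k\in\mathbb{N}$ and $H\in\mathit{trd}(\mathcal{A},k)$: $H\sqsubseteq_k H'$ iff $P_H(\sigma)=P_{H'}(\sigma)$ for all $\sigma\in L^k$; $\mathit{outcont}(H,\mathcal{A},k)=\{H'\in\mathit{trd}(\mathcal{A},k+1)\mid H\sqsubseteq_k H' \text{ and } P_{H'}(\sigma)=0 \text{ for all }\sigma\in L^kL_I\}$. pioco: $\mathcal{A}_i\sqsubseteq_{\mathit{pioco}}\mathcal{A}_s$ iff for all $k\in\mathbb{N}$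 and all $H\in\mathit{trd}(\mathcal{A}_s,k)$, $\mathit{outcont}(H,\mathcal{A}_i,k)\subseteq\mathit{outcont}(H,\mathcal{A}_s,k)$. (The paper introduces this relation for input-enabled $\mathcal{A}_i$, but the condition itself makes sense for arbitrary pQTSs.) -}

module Defs where

open import Level using (0ℓ)
open import Data.Nat using (ℕ; zero; suc)
import Data.Nat as ℕ
open import Data.Fin using (Fin; zero; suc)
import Data.Fin.Properties as FinP
open import Data.Sum using (_⊎_; inj₁; inj₂)
import Data.Sum.Properties as SumP
open import Data.Product using (Σ; _×_; _,_)
open import Data.Maybe using (Maybe; just; nothing)
open import Data.List using (List; []; _∷_; _++_; [_]; length; map; reverse)
import Data.List.Properties as ListP
open import Data.Bool using (if_then_else_)
open import Relation.Nullary using (¬_)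
open import Relation.Nullary.Decidable using (⌊_⌋)
open import Relation.Binary.PropositionalEquality using (_≡_; _≢_)
open import Relation.Binary.Core using (Rel)
open import Relation.Binary.Structures using (IsTotalOrder)
open import Relation.Binary.Definitions using (DecidableEquality)
open import Algebra.Core using (Op₁; Op₂)
open import Algebra.Structures using (IsCommutativeRing)

-- Probability values: an arbitrary ordered field (ℝ is a model).

record OrderedField : Set₁ where
  infixl 6 _+_
  infixl 7 _*_
  infix 4 _≤_
  field
    Carrier : Set
    _+_ _*_ : Op₂ Carrier
    -_ : Op₁ Carrier
    0# 1# : Carrier
    _≤_ : Rel Carrier 0ℓ
    isCommutativeRing : IsCommutativeRing _≡_ _+_ _*_ -_ 0# 1#
    ≤-isTotalOrder : IsTotalOrder _≡_ _≤_
    +-mono-≤ : ∀ {x y} z → x ≤ y → x + z ≤ y + z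
    *-nonneg : ∀ {x y} → 0# ≤ x → 0# ≤ y → 0# ≤ x * y
    0≢1 : 0# ≢ 1#
    inverse : ∀ x → x ≢ 0# → Σ Carrier (λ y → x * y ≡ 1#)

  _<_ : Rel Carrier 0ℓ
  x < y = (x ≤ y) × (x ≢ y)

-- Action signature (L_I, L_O^δ): finitely many inputs and outputs,
-- with a distinguished quiescence output δ.

record Signature : Set where
  field
    nI nO : ℕ
    δ : Fin nO

Label : Signature → Set
Label σ = Fin (Signature.nI σ) ⊎ Fin (Signature.nO σ)

Input : Signature → Set
Input σ = Fin (Signature.nI σ)

_≟L_ : {σ : Signature} → DecidableEquality (Label σ)
_≟L_ = SumP.≡-dec FinP._≟_ FinP._≟_

module _ (F : OrderedField) where
  open OrderedField F

  sumFin : {n : ℕ} → (Fin n → Carrier) → Carrier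
  sumFin {zero} f = 0#
  sumFin {suc n} f = f zero + sumFin (λ i → f (suc i))

  sumLabel : (σ : Signature) → (Label σ → Carrier) → Carrier
  sumLabel σ f = sumFin (λ i → f (inj₁ i)) + sumFin (λ o → f (inj₂ o))

  -- pQTS.  States: Fin nS.  The finite transition relation Δ is
  -- enumerated without duplicates as Fin nT, transition j being
  -- (src j , dist j) with dist j ∈ Distr(L × S).

  record PQTS (σ : Signature) : Set where
    field
      nS : ℕ
      s₀ : Fin nS
      nT : ℕ
      src : Fin nT → Fin nS
      dist : Fin nT → Label σ → Fin nS → Carrier
      dist-nonneg : ∀ j a s → 0# ≤ dist j a s
      dist-sum : ∀ j → sumLabel σ (λ a → sumFin (λ s → dist j a s)) ≡ 1#
      noDup : ∀ j j′ → src j ≡ src j′ → (∀ a s → dist j a s ≡ dist j′ a s) → j ≡ j′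
      inputCond : ∀ j (i : Input σ) s → 0# < dist j (inj₁ i) s →
                  ∀ b s″ → b ≢ inj₁ i → dist j b s″ ≡ 0#

  module _ {σ : Signature} (A : PQTS σ) where
    open PQTS A

    Step : Set
    Step = Fin nT × Label σ × Fin nS

    -- finite paths from s₀, most recent step first (snoc-list)
    Path : Set
    Path = List Step

    last : Path → Fin nS
    last [] = s₀
    last ((_ , _ , t) ∷ _) = t

    trace : Path → List (Label σ)
    trace π = reverse (map (λ { (_ , a , _) → a }) π)

    -- Adversaries.  E π : distribution over Δ ∪ {⊥}, ⊥ = nothing.
    record Adversary : Set where
      field
        E : Path → Maybe (Fin nT) → Carrier
        E-nonneg : ∀ π x → 0# ≤ E π x
        E-sum : ∀ π → E π nothing + sumFin (λ j → E π (just j)) ≡ 1#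
        E-support : ∀ π j → src j ≢ last π → E π (just j) ≡ 0#

    HaltsAfter : ℕ → Adversary → Set
    HaltsAfter k Ad = ∀ π → k ℕ.≤ length π → Adversary.E Ad π nothing ≡ 1#

    Q : Adversary → Path → Carrier
    Q Ad [] = 1#
    Q Ad ((j , a , t) ∷ π) = Q Ad π * Adversary.E Ad π (just j) * dist j a t

    sumPaths : ℕ → (Path → Carrier) → Carrier
    sumPaths zero f = f []
    sumPaths (suc ℓ) f =
      sumPaths ℓ (λ π → sumFin (λ j → sumLabel σ (λ a → sumFin (λ t → f ((j , a , t) ∷ π)))))

    -- P_H(β) for H = trd(E): total Q-mass of paths with trace β
    -- (step sequences that are not paths have Q = 0)
    P : Adversary → List (Label σ) → Carrier
    P Ad β = sumPaths (length β)
      (λ π → if ⌊ ListP.≡-dec (_≟L_ {σ}) (trace π) β ⌋ then Q Ad π else 0#)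

  -- trace distributions are represented by their cone function β ↦ P_H(β)
  TraceDist : Signature → Set
  TraceDist σ = List (Label σ) → Carrier

  InTrd : {σ : Signature} → PQTS σ → TraceDist σ → Set
  InTrd A H = Σ (Adversary A) (λ Ad → ∀ β → P A Ad β ≡ H β)

  InTrdK : {σ : Signature} → PQTS σ → ℕ → TraceDist σ → Set
  InTrdK A k H = Σ (Adversary A) (λ Ad → HaltsAfter A k Ad × (∀ β → P A Ad β ≡ H β))

  _⊑TD_ : {σ : Signature} → PQTS σ → PQTS σ → Set
  A ⊑TD B = ∀ H → InTrd A H → InTrd B H

  _⊑[_]_ : {σ : Signature} → TraceDist σ → ℕ → TraceDist σ → Set
  H ⊑[ k ] H′ = ∀ β → length β ≡ k → H β ≡ H′ β

  InOutcont : {σ : Signature} → TraceDist σ → PQTS σ → ℕ → TraceDist σ → Set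
  InOutcont {σ} H A k H′ =
    InTrdK A (suc k) H′ × (_⊑[_]_ {σ} H k H′) ×
    (∀ β (i : Input σ) → length β ≡ k → H′ (β ++ [ inj₁ i ]) ≡ 0#)

  _⊑pioco_ : {σ : Signature} → PQTS σ → PQTS σ → Set
  Ai ⊑pioco As = ∀ k H → InTrdK As k H → ∀ H′ → InOutcont H Ai k H′ → InOutcont H As k H′

{-# OPTIONS --safe #-}
-- An output continuation of A_i is a trace distribution of A_i that halts after k + 1 steps.
-- Trace inclusion yields an adversary of A_s with the same trace distribution; stopping
-- that adversary after k + 1 steps changes no cone of length ≤ k + 1, while every longer
-- cone has probability 0 both for the stopped adversary and for the given distribution.
-- So trace inclusion restricts to trace distributions of bounded length, which is all
-- that pioco asks for.
module Submission where

open import Defs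
open import Data.Nat using (ℕ; zero; suc; s≤s)
import Data.Nat as ℕ
open import Data.Nat.Properties using (<⇒≤; <⇒≱; ≰⇒>)
open import Data.Fin using (Fin; zero; suc)
open import Data.Sum using (inj₁; inj₂)
open import Data.Product using (_,_)
open import Data.Maybe using (Maybe; just; nothing)
open import Data.List using ([]; _∷_; length)
open import Data.Bool using (true; false; if_then_else_)
open import Data.Empty using (⊥-elim)
open import Relation.Nullary using (yes; no)
open import Relation.Binary.PropositionalEquality
open import Relation.Binary.Structures using (IsTotalOrder)
open import Algebra.Bundles using (CommutativeRing)
open import Algebra.Structures using (IsCommutativeRing)
import Algebra.Properties.Ring as RingProperties

module _ (F : OrderedField) where
  open OrderedField F

  private
    commutativeRing : CommutativeRing _ _
    commutativeRing = record { isCommutativeRing = isCommutativeRing }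

  open IsCommutativeRing isCommutativeRing using (+-identityˡ; +-identityʳ; +-comm; zeroˡ; zeroʳ)
  open IsTotalOrder ≤-isTotalOrder using (antisym) renaming (refl to ≤-refl; trans to ≤-trans)
  open RingProperties (CommutativeRing.ring commutativeRing) using (+-identityʳ-unique)

  +-nonneg : ∀ {x y} → 0# ≤ x → 0# ≤ y → 0# ≤ x + y
  +-nonneg {x} {y} 0≤x 0≤y = ≤-trans 0≤y (subst (_≤ x + y) (+-identityˡ y) (+-mono-≤ y 0≤x))

  +-nonneg-≡0ˡ : ∀ {x y} → 0# ≤ x → 0# ≤ y → x + y ≡ 0# → x ≡ 0#
  +-nonneg-≡0ˡ {x} {y} 0≤x 0≤y x+y≡0 =
    antisym (subst₂ _≤_ (+-identityˡ x) (trans (+-comm y x) x+y≡0) (+-mono-≤ x 0≤y)) 0≤x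

  +-nonneg-≡0ʳ : ∀ {x y} → 0# ≤ x → 0# ≤ y → x + y ≡ 0# → y ≡ 0#
  +-nonneg-≡0ʳ {x} {y} 0≤x 0≤y x+y≡0 = +-nonneg-≡0ˡ 0≤y 0≤x (trans (+-comm y x) x+y≡0)

  sumFin-cong : ∀ {n} {f g : Fin n → Carrier} → (∀ i → f i ≡ g i) → sumFin F f ≡ sumFin F g
  sumFin-cong {zero} f≗g = refl
  sumFin-cong {suc n} f≗g = cong₂ _+_ (f≗g zero) (sumFin-cong (λ i → f≗g (suc i)))

  sumFin-zero : ∀ n → sumFin F {n} (λ _ → 0#) ≡ 0#
  sumFin-zero zero = refl
  sumFin-zero (suc n) = trans (cong (0# +_) (sumFin-zero n)) (+-identityˡ 0#)

  sumFin-nonneg : ∀ {n} {f : Fin n → Carrier} → (∀ i → 0# ≤ f i) → 0# ≤ sumFin F f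
  sumFin-nonneg {zero} 0≤f = ≤-refl
  sumFin-nonneg {suc n} 0≤f = +-nonneg (0≤f zero) (sumFin-nonneg (λ i → 0≤f (suc i)))

  sumFin-nonneg-≡0 : ∀ {n} {f : Fin n → Carrier} → (∀ i → 0# ≤ f i) → sumFin F f ≡ 0# → ∀ i → f i ≡ 0#
  sumFin-nonneg-≡0 {suc n} 0≤f Σf≡0 zero = +-nonneg-≡0ˡ (0≤f zero) (sumFin-nonneg (λ i → 0≤f (suc i))) Σf≡0
  sumFin-nonneg-≡0 {suc n} 0≤f Σf≡0 (suc i) =
    sumFin-nonneg-≡0 (λ i → 0≤f (suc i))
      (+-nonneg-≡0ʳ (0≤f zero) (sumFin-nonneg (λ i → 0≤f (suc i))) Σf≡0) i

  sumLabel-cong : ∀ σ {f g : Label σ → Carrier} → (∀ a → f a ≡ g a) → sumLabel F σ f ≡ sumLabel F σ g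
  sumLabel-cong σ f≗g = cong₂ _+_ (sumFin-cong (λ i → f≗g (inj₁ i))) (sumFin-cong (λ o → f≗g (inj₂ o)))

  sumLabel-zero : ∀ σ → sumLabel F σ (λ _ → 0#) ≡ 0#
  sumLabel-zero σ =
    trans (cong₂ _+_ (sumFin-zero (Signature.nI σ)) (sumFin-zero (Signature.nO σ))) (+-identityˡ 0#)

  if-then-0 : ∀ b {x} → x ≡ 0# → (if b then x else 0#) ≡ 0#
  if-then-0 true x≡0 = x≡0
  if-then-0 false x≡0 = refl

  module _ {σ : Signature} (A : PQTS F σ) where
    open PQTS A

    sumPaths-cong : ∀ ℓ {f g : Path F A → Carrier} → (∀ π → length π ≡ ℓ → f π ≡ g π) →
                    sumPaths F A ℓ f ≡ sumPaths F A ℓ g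
    sumPaths-cong zero f≗g = f≗g [] refl
    sumPaths-cong (suc ℓ) f≗g = sumPaths-cong ℓ λ π |π|≡ℓ →
      sumFin-cong λ j → sumLabel-cong σ λ a → sumFin-cong λ t → f≗g ((j , a , t) ∷ π) (cong suc |π|≡ℓ)

    sumPaths-zero : ∀ ℓ → sumPaths F A ℓ (λ _ → 0#) ≡ 0#
    sumPaths-zero zero = refl
    sumPaths-zero (suc ℓ) = trans (sumPaths-cong ℓ (λ _ _ → step-zero)) (sumPaths-zero ℓ)
      where
      step-zero : sumFin F {nT} (λ _ → sumLabel F σ (λ _ → sumFin F {nS} (λ _ → 0#))) ≡ 0#
      step-zero = trans (sumFin-cong {nT} λ _ → trans (sumLabel-cong σ λ _ → sumFin-zero nS) (sumLabel-zero σ))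
                        (sumFin-zero nT)

    P-cong : ∀ {Ad Ad′ : Adversary F A} β →
             (∀ π → length π ≡ length β → Q F A Ad π ≡ Q F A Ad′ π) → P F A Ad β ≡ P F A Ad′ β
    P-cong β Q≗Q′ = sumPaths-cong (length β) λ π |π|≡|β| →
      cong (if _ then_else 0#) (Q≗Q′ π |π|≡|β|)

    P-zero : ∀ {Ad : Adversary F A} β → (∀ π → length π ≡ length β → Q F A Ad π ≡ 0#) → P F A Ad β ≡ 0#
    P-zero β Q≡0 = trans (sumPaths-cong (length β) λ π |π|≡|β| → if-then-0 _ (Q≡0 π |π|≡|β|))
                         (sumPaths-zero (length β))

    halted⇒no-transition : ∀ (Ad : Adversary F A) π → Adversary.E Ad π nothing ≡ 1# →
                           ∀ j → Adversary.E Ad π (just j) ≡ 0#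
    halted⇒no-transition Ad π halted =
      sumFin-nonneg-≡0 (λ j → E-nonneg π (just j))
        (+-identityʳ-unique 1# _ (subst (λ h → h + sumFin F (λ j → E π (just j)) ≡ 1#) halted (E-sum π)))
      where open Adversary Ad

    Q-halting-long : ∀ {m} (Ad : Adversary F A) → HaltsAfter F A m Ad →
                     ∀ π → m ℕ.< length π → Q F A Ad π ≡ 0#
    Q-halting-long Ad halts ((j , a , t) ∷ π) (s≤s m≤|π|) = begin
      Q F A Ad π * Adversary.E Ad π (just j) * dist j a t
        ≡⟨ cong (λ e → Q F A Ad π * e * dist j a t) (halted⇒no-transition Ad π (halts π m≤|π|) j) ⟩
      Q F A Ad π * 0# * dist j a t  ≡⟨ cong (_* dist j a t) (zeroʳ _) ⟩
      0# * dist j a t               ≡⟨ zeroˡ _ ⟩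
      0#                            ∎
      where open ≡-Reasoning

    P-halting-long : ∀ {m} (Ad : Adversary F A) → HaltsAfter F A m Ad →
                     ∀ β → m ℕ.< length β → P F A Ad β ≡ 0#
    P-halting-long Ad halts β m<|β| =
      P-zero β λ π |π|≡|β| → Q-halting-long Ad halts π (subst (_ ℕ.<_) (sym |π|≡|β|) m<|β|)

    -- After k steps all scheduling mass goes to halting; writing it as E π ⊥ + Σⱼ E π j (= 1)
    -- makes its nonnegativity immediate.
    haltAfter : ℕ → Adversary F A → Adversary F A
    haltAfter k Ad = record { E = E′ ; E-nonneg = E′-nonneg ; E-sum = E′-sum ; E-support = E′-support }
      where
      open Adversary Ad
      E′ : Path F A → Maybe (Fin nT) → Carrier
      E′ π x with length π ℕ.<? k
      ... | yes _ = E π x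
      E′ π nothing | no _ = E π nothing + sumFin F (λ j → E π (just j))
      E′ π (just _) | no _ = 0#
      E′-nonneg : ∀ π x → 0# ≤ E′ π x
      E′-nonneg π x with length π ℕ.<? k
      ... | yes _ = E-nonneg π x
      E′-nonneg π nothing | no _ = +-nonneg (E-nonneg π nothing) (sumFin-nonneg λ j → E-nonneg π (just j))
      E′-nonneg π (just _) | no _ = ≤-refl
      E′-sum : ∀ π → E′ π nothing + sumFin F (λ j → E′ π (just j)) ≡ 1#
      E′-sum π with length π ℕ.<? k
      ... | yes _ = E-sum π
      ... | no _ = trans (cong₂ _+_ (E-sum π) (sumFin-zero nT)) (+-identityʳ 1#)
      E′-support : ∀ π j → src j ≢ last F A π → E′ π (just j) ≡ 0#
      E′-support π j src≢last with length π ℕ.<? k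
      ... | yes _ = E-support π j src≢last
      ... | no _ = refl

    module _ (k : ℕ) (Ad : Adversary F A) where
      open Adversary

      haltAfter-E : ∀ π x → length π ℕ.< k → E (haltAfter k Ad) π x ≡ E Ad π x
      haltAfter-E π x |π|<k with length π ℕ.<? k
      ... | yes _ = refl
      ... | no |π|≮k = ⊥-elim (|π|≮k |π|<k)

      haltAfter-halts : HaltsAfter F A k (haltAfter k Ad)
      haltAfter-halts π k≤|π| with length π ℕ.<? k
      ... | yes |π|<k = ⊥-elim (<⇒≱ |π|<k k≤|π|)
      ... | no _ = E-sum Ad π

      Q-haltAfter : ∀ π → length π ℕ.≤ k → Q F A (haltAfter k Ad) π ≡ Q F A Ad π
      Q-haltAfter [] _ = refl
      Q-haltAfter ((j , a , t) ∷ π) |π|<k =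
        cong₂ (λ q e → q * e * dist j a t) (Q-haltAfter π (<⇒≤ |π|<k)) (haltAfter-E π (just j) |π|<k)

      P-haltAfter : ∀ β → length β ℕ.≤ k → P F A (haltAfter k Ad) β ≡ P F A Ad β
      P-haltAfter β |β|≤k = P-cong β λ π |π|≡|β| → Q-haltAfter π (subst (ℕ._≤ k) (sym |π|≡|β|) |β|≤k)

    InTrdK⇒InTrd : ∀ {k H} → InTrdK F A k H → InTrd F A H
    InTrdK⇒InTrd (Ad , _ , P≗H) = Ad , P≗H

    InTrdK-long≡0 : ∀ {k H} → InTrdK F A k H → ∀ β → k ℕ.< length β → H β ≡ 0#
    InTrdK-long≡0 (Ad , halts , P≗H) β k<|β| = trans (sym (P≗H β)) (P-halting-long Ad halts β k<|β|)

    InTrd⇒InTrdK : ∀ {k H} → InTrd F A H → (∀ β → k ℕ.< length β → H β ≡ 0#) → InTrdK F A k H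
    InTrd⇒InTrdK {k} {H} (Ad , P≗H) H-long≡0 = haltAfter k Ad , haltAfter-halts k Ad , P′≗H
      where
      P′≗H : ∀ β → P F A (haltAfter k Ad) β ≡ H β
      P′≗H β with length β ℕ.≤? k
      ... | yes |β|≤k = trans (P-haltAfter k Ad β |β|≤k) (P≗H β)
      ... | no |β|≰k  = trans (P-halting-long (haltAfter k Ad) (haltAfter-halts k Ad) β (≰⇒> |β|≰k))
                              (sym (H-long≡0 β (≰⇒> |β|≰k)))

  ⊑TD⇒InTrdK-⊆ : ∀ {σ} {A B : PQTS F σ} → _⊑TD_ F A B → ∀ {k H} → InTrdK F A k H → InTrdK F B k H
  ⊑TD⇒InTrdK-⊆ {B = B} A⊑B H∈trdA,k =
    InTrd⇒InTrdK B (A⊑B _ (InTrdK⇒InTrd _ H∈trdA,k)) (InTrdK-long≡0 _ H∈trdA,k)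

mainTheorem2 : (F : OrderedField) (σ : Signature) (Ai As : PQTS F σ) →
               _⊑TD_ F Ai As → _⊑pioco_ F Ai As
mainTheorem2 F σ Ai As Ai⊑As k H _ H′ (H′∈trdAi , H⊑H′ , no-inputs) =
  ⊑TD⇒InTrdK-⊆ F Ai⊑As H′∈trdAi , H⊑H′ , no-inputs
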